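{- Let $n\geq1$ and suppose $\Delta^n\to\mathcal{C}$. Then $-\lfloor(n+1-k)/2\rfloor\leq\mathcal{C}(k)\leq\lfloor k/2\rfloor$ for all $1\leq k\leq n$.
   Context: Labeled chip-firing on $\mathbb{Z}$: a labeled configuration is $\mathcal{C}\colon X\to\mathbb{Z}$, $X\subseteq\mathbb{Z}_{>0}$ finite, chip $(i)$ at vertex $\mathcal{C}(i)$; a move fires chips $(a),(b)$ with $a<b$ at a common vertex $i$, sending $(a)$ to $i-1$ and $(b)$ to $i+1$; $\mathcal{C}\to\mathcal{D}$ means reachable by zero or more moves. $\Delta^n$ has chips $(1),\ldots,(n)$ all at vertex $0$. -}

module Defs where

open import Data.Nat using (ℕ; suc; _∸_; _/_)
open import Data.Fin using (Fin; toℕ; _<_)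
open import Data.Fin.Properties using (_≟_)
open import Data.Integer using (ℤ; +_; -_; _+_; _-_; 0ℤ; 1ℤ)
open import Relation.Nullary using (yes; no)
open import Relation.Binary.PropositionalEquality using (_≡_)

-- A labeled configuration with chips (1),…,(n): chip (i+1) (i : Fin n)
-- sits at vertex C i.  (Chip labels are Fin n, shifted by one.)
Config : ℕ → Set
Config n = Fin n → ℤ

Δ : (n : ℕ) → Config n
Δ n _ = 0ℤ

fire : ∀ {n} → Config n → Fin n → Fin n → Config n
fire C a b j with j ≟ a
... | yes _ = C j - 1ℤ
... | no _ with j ≟ b
...   | yes _ = C j + 1ℤ
...   | no _  = C j

data Move {n : ℕ} (C : Config n) : Config n → Set where
  move : (a b : Fin n) → a < b → C a ≡ C b → Move C (fire C a b)

data _⟶*_ {n : ℕ} : Config n → Config n → Set where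
  done : ∀ {C} → C ⟶* C
  step : ∀ {C D E} → Move C D → D ⟶* E → C ⟶* E

-- For a set W of chips and a vertex v put Φ_W(v) = Σ_{j ∈ W} (C j − v)⁺.  Firing two chips
-- of W at v raises Φ_W by one at v and leaves it unchanged elsewhere, and firing a chip of W
-- against a chip outside W to its right (which then moves left) does not increase it.  So if
-- W is closed under smaller labels and has at most 2m + 1 chips, the invariant
-- Φ_W(v) ≤ T((m − v)⁺), T the triangular numbers, holds at Δⁿ and survives every move: at a
-- vertex v carrying two chips of W the second difference of Φ_W is at least 2 while that of
-- T((m − ·)⁺) is at most 1, so the invariant is strict there.  At v = m it bounds every chip
-- of W by m.  W = {1,…,k} gives the upper bound, and the mirror image of the same argument
-- with W = {k,…,n} the lower one.
module Submission where

open import Defs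
open import Data.Nat using (ℕ; suc; _∸_; _/_)
open import Data.Fin using (Fin; toℕ)
open import Data.Integer using (ℤ; +_; -_; _≤_)
open import Data.Product using (_×_)

open import Data.Bool using (Bool; true; false; T; if_then_else_)
open import Data.Empty using (⊥-elim)
open import Data.Fin using (zero; suc; punchIn; punchOut)
open import Data.Fin.Properties using (_≟_; punchIn-punchOut; punchInᵢ≢i; punchIn-injective)
open import Data.Integer as ℤ using (-[1+_]; 0ℤ; 1ℤ; _-_)
import Data.Integer.Properties as ℤ
import Data.Integer.Tactic.RingSolver as ℤ
open import Data.Nat as ℕ using (zero; _+_; _*_; _<ᵇ_; _≤ᵇ_; z≤n; s≤s)
import Data.Nat.Properties as ℕ
open import Data.Nat.DivMod using (m≡m%n+[m/n]*n; m%n<n)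
import Data.Nat.Tactic.RingSolver as ℕ
open import Data.Product using (_,_)
open import Data.Vec.Functional using (Vector; removeAt)
open import Algebra.Properties.CommutativeMonoid.Sum ℕ.+-0-commutativeMonoid
  using (sum; sum-remove; ∑-distrib-+; sum-cong-≗)
open import Function using (id)
open import Relation.Binary.PropositionalEquality
open import Relation.Nullary using (yes; no; contradiction)

if-T : ∀ {A : Set} {b} {x y : A} → T b → (if b then x else y) ≡ x
if-T {b = true} _ = refl

∑-mono-≤ : ∀ {n} {s t : Vector ℕ n} → (∀ j → s j ℕ.≤ t j) → sum s ℕ.≤ sum t
∑-mono-≤ {zero}  _   = z≤n
∑-mono-≤ {suc n} s≤t = ℕ.+-mono-≤ (s≤t zero) (∑-mono-≤ (λ j → s≤t (suc j)))

∑-≥-term : ∀ {n} (t : Vector ℕ n) i → t i ℕ.≤ sum t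
∑-≥-term {suc n} t i = ℕ.≤-trans (ℕ.m≤m+n (t i) _) (ℕ.≤-reflexive (sym (sum-remove {i = i} t)))

∑-remove₂ : ∀ {n} (t : Vector ℕ (suc (suc n))) {x y} (x≢y : x ≢ y) →
  sum t ≡ t x + (t y + sum (removeAt (removeAt t x) (punchOut x≢y)))
∑-remove₂ t {x} {y} x≢y = begin
  sum t                                                   ≡⟨ sum-remove t ⟩
  t x + sum (removeAt t x)                                ≡⟨ cong (λ s → t x + s) (sum-remove (removeAt t x)) ⟩
  t x + (t (punchIn x (punchOut x≢y)) + sum rest)         ≡⟨ cong (λ j → t x + (t j + sum rest)) (punchIn-punchOut x≢y) ⟩
  t x + (t y + sum rest)                                  ∎
  where
  open ≡-Reasoning
  rest = removeAt (removeAt t x) (punchOut x≢y)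

∑-≥-pair : ∀ {n} (t : Vector ℕ n) {x y} → x ≢ y → t x + t y ℕ.≤ sum t
∑-≥-pair {zero}        t {()}
∑-≥-pair {suc zero}    t {zero} {zero} x≢y = contradiction refl x≢y
∑-≥-pair {suc (suc n)} t {x}    {y}    x≢y = begin
  t x + t y              ≤⟨ ℕ.+-monoʳ-≤ (t x) (ℕ.m≤m+n (t y) _) ⟩
  t x + (t y + _)        ≡⟨ sym (∑-remove₂ t x≢y) ⟩
  sum t                  ∎
  where open ℕ.≤-Reasoning

∑-≤-pair : ∀ {n} {s t : Vector ℕ n} {x y} c → x ≢ y →
  s x + s y ℕ.≤ c + (t x + t y) → (∀ j → j ≢ x → j ≢ y → s j ℕ.≤ t j) → sum s ℕ.≤ c + sum t
∑-≤-pair {zero}                 {x = ()}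
∑-≤-pair {suc zero}             {x = zero} {zero} c x≢y = contradiction refl x≢y
∑-≤-pair {suc (suc n)} {s} {t} {x}        {y}    c x≢y pair apart = begin
  sum s                              ≡⟨ ∑-remove₂ s x≢y ⟩
  s x + (s y + sum (rest s))         ≡⟨ sym (ℕ.+-assoc (s x) _ _) ⟩
  (s x + s y) + sum (rest s)         ≤⟨ ℕ.+-mono-≤ pair (∑-mono-≤ rest-≤) ⟩
  (c + (t x + t y)) + sum (rest t)   ≡⟨ reassociate c (t x) (t y) _ ⟩
  c + (t x + (t y + sum (rest t)))   ≡⟨ cong (λ r → c + r) (sym (∑-remove₂ t x≢y)) ⟩
  c + sum t                          ∎
  where
  open ℕ.≤-Reasoning
  rest : Vector ℕ (suc (suc n)) → Vector ℕ n
  rest u = removeAt (removeAt u x) (punchOut x≢y)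
  rest-≤ : ∀ k → rest s k ℕ.≤ rest t k
  rest-≤ k = apart _ (punchInᵢ≢i x _) λ eq →
    punchInᵢ≢i (punchOut x≢y) k (punchIn-injective x _ _ (trans eq (sym (punchIn-punchOut x≢y))))
  reassociate : ∀ c a b r → (c + (a + b)) + r ≡ c + (a + (b + r))
  reassociate = ℕ.solve-∀

double-cancel-< : ∀ {a b} → a + a ℕ.< b + b → a ℕ.< b
double-cancel-< a+a<b+b = ℕ.≰⇒> λ b≤a → ℕ.<⇒≱ a+a<b+b (ℕ.+-mono-≤ b≤a b≤a)

≤-suc-double-/2 : ∀ k → k ℕ.≤ suc (k / 2 + k / 2)
≤-suc-double-/2 k = begin
  k                  ≡⟨ m≡m%n+[m/n]*n k 2 ⟩
  k ℕ.% 2 + k / 2 * 2 ≤⟨ ℕ.+-monoˡ-≤ _ (ℕ.≤-pred (m%n<n k 2)) ⟩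
  1 + k / 2 * 2      ≡⟨ cong suc (ℕ.*-comm (k / 2) 2) ⟩
  1 + 2 * (k / 2)    ≡⟨ cong (λ h → suc (k / 2 + h)) (ℕ.+-identityʳ (k / 2)) ⟩
  suc (k / 2 + k / 2) ∎
  where open ℕ.≤-Reasoning

triangle : ℕ → ℕ
triangle zero    = 0
triangle (suc j) = suc j + triangle j

-- Both sides grow by the same amount along the diagonal m ↦ m + 1, w ↦ w + 1.
odd-*-≤-triangle : ∀ m w → suc (m + m) * w ℕ.≤ triangle (m + w)
odd-*-≤-triangle m       zero    rewrite ℕ.*-zeroʳ (suc (m + m)) = z≤n
odd-*-≤-triangle zero    (suc w) = ℕ.+-monoʳ-≤ (suc w) z≤n
odd-*-≤-triangle (suc m) (suc w) = begin
  suc (suc m + suc m) * suc w                                    ≡⟨ diagonal m w ⟩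
  (suc (suc (m + w)) + suc (m + w)) + suc (m + m) * w           ≤⟨ ℕ.+-monoʳ-≤ _ (odd-*-≤-triangle m w) ⟩
  (suc (suc (m + w)) + suc (m + w)) + triangle (m + w)          ≡⟨ ℕ.+-assoc (suc (suc (m + w))) _ _ ⟩
  triangle (suc (suc (m + w)))                                   ≡⟨ cong triangle (sym (ℕ.+-suc (suc m) w)) ⟩
  triangle (suc m + suc w)                                       ∎
  where
  open ℕ.≤-Reasoning
  diagonal : ∀ m w → suc (suc m + suc m) * suc w ≡ (suc (suc (m + w)) + suc (m + w)) + suc (m + m) * w
  diagonal = ℕ.solve-∀

_⁺ : ℤ → ℕ
(+ n)    ⁺ = n
-[1+ _ ] ⁺ = 0

δ₀ : ℤ → ℕ
δ₀ (+ zero)  = 1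
δ₀ (+ suc _) = 0
δ₀ -[1+ _ ]  = 0

δ₀-≡ : ∀ {a v} → a ≡ v → δ₀ (a - v) ≡ 1
δ₀-≡ {v = v} refl = cong δ₀ (ℤ.+-inverseʳ v)

δ₀-≢ : ∀ {a v} → a ≢ v → δ₀ (a - v) ≡ 0
δ₀-≢ {a} {v} a≢v with a - v in eq
... | + zero   = contradiction (ℤ.i-j≡0⇒i≡j a v eq) a≢v
... | + suc _  = refl
... | -[1+ _ ] = refl

⁺-second-difference : ∀ y → (y ℤ.+ 1ℤ) ⁺ + (y - 1ℤ) ⁺ ≡ (y ⁺ + y ⁺) + δ₀ y
⁺-second-difference (+ zero)        = refl
⁺-second-difference (+ suc k)       = identity k
  where
  identity : ∀ k → (suc k + 1) + k ≡ (suc k + suc k) + 0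
  identity = ℕ.solve-∀
⁺-second-difference -[1+ zero ]     = refl
⁺-second-difference -[1+ suc _ ]    = refl

⁺-pred-≤ : ∀ y → (y - 1ℤ) ⁺ ℕ.≤ y ⁺
⁺-pred-≤ (+ zero)   = z≤n
⁺-pred-≤ (+ suc k)  = ℕ.n≤1+n k
⁺-pred-≤ -[1+ _ ]   = z≤n

⁺≡0⇒≤0 : ∀ {y} → y ⁺ ≡ 0 → y ℤ.≤ 0ℤ
⁺≡0⇒≤0 {+ zero}   _ = ℤ.+≤+ z≤n
⁺≡0⇒≤0 { -[1+ _ ]} _ = ℤ.-≤+

triangle-⁺-second-difference : ∀ y →
  triangle ((y ℤ.+ 1ℤ) ⁺) + triangle ((y - 1ℤ) ⁺) ℕ.≤ suc (triangle (y ⁺) + triangle (y ⁺))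
triangle-⁺-second-difference (+ zero)   = ℕ.≤-refl
triangle-⁺-second-difference (+ suc k)  rewrite ℕ.+-comm k 1 = ℕ.≤-reflexive (identity k (triangle k))
  where
  identity : ∀ k t → (suc (suc k) + (suc k + t)) + t ≡ suc ((suc k + t) + (suc k + t))
  identity = ℕ.solve-∀
triangle-⁺-second-difference -[1+ zero ]  = z≤n
triangle-⁺-second-difference -[1+ suc _ ] = z≤n

sub-pred : ∀ a v → a - (v - 1ℤ) ≡ (a - v) ℤ.+ 1ℤ
sub-pred = ℤ.solve-∀

sub-suc : ∀ a v → a - (v ℤ.+ 1ℤ) ≡ (a - v) - 1ℤ
sub-suc = ℤ.solve-∀

pred-sub : ∀ a v → (a - 1ℤ) - v ≡ (a - v) - 1ℤ
pred-sub = ℤ.solve-∀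

suc-sub : ∀ a v → (a ℤ.+ 1ℤ) - v ≡ (a - v) ℤ.+ 1ℤ
suc-sub = ℤ.solve-∀

∣_∣ : ∀ {n} → (Fin n → Bool) → ℕ
∣ W ∣ = sum (λ j → if W j then 1 else 0)

∑-if-const : ∀ {n} (W : Fin n → Bool) r → sum (λ j → if W j then r else 0) ≡ ∣ W ∣ * r
∑-if-const {zero}  W r = refl
∑-if-const {suc n} W r with W zero
... | true  = cong (λ s → r + s) (∑-if-const (λ j → W (suc j)) r)
... | false = ∑-if-const (λ j → W (suc j)) r

-- Stated with _<ᵇ_ and _≤ᵇ_ so that the membership tests reduce once n and k are constructors.
count-<ᵇ : ∀ n k → ∣ (λ (j : Fin n) → toℕ j <ᵇ k) ∣ ℕ.≤ k
count-<ᵇ zero    k       = z≤n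
count-<ᵇ (suc n) zero    = count-<ᵇ n zero
count-<ᵇ (suc n) (suc k) = s≤s (count-<ᵇ n k)

count-≤ᵇ : ∀ n k → ∣ (λ (j : Fin n) → k ≤ᵇ toℕ j) ∣ ℕ.≤ n ∸ k
count-≤ᵇ zero    k             = z≤n
count-≤ᵇ (suc n) zero          = s≤s (count-≤ᵇ n zero)
count-≤ᵇ (suc n) (suc zero)    = count-≤ᵇ n zero
count-≤ᵇ (suc n) (suc (suc k)) = count-≤ᵇ n (suc k)

excess : ∀ {n} → (Fin n → Bool) → Config n → ℤ → ℕ
excess W D v = sum (λ j → if W j then (D j - v) ⁺ else 0)

occupancy : ∀ {n} → (Fin n → Bool) → Config n → ℤ → ℕ
occupancy W D v = sum (λ j → if W j then δ₀ (D j - v) else 0)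

-- The excess of 2m + 1 chips at −m, …, m, for v ≥ −m.
capacity : ℕ → ℤ → ℕ
capacity m v = triangle ((+ m - v) ⁺)

Dominated : ∀ {n} → (Fin n → Bool) → ℕ → Config n → Set
Dominated W m D = ∀ v → excess W D v ℕ.≤ capacity m v

excess-second-difference : ∀ {n} (W : Fin n → Bool) D v →
  excess W D (v - 1ℤ) + excess W D (v ℤ.+ 1ℤ) ≡ (excess W D v + excess W D v) + occupancy W D v
excess-second-difference W D v = begin
  excess W D (v - 1ℤ) + excess W D (v ℤ.+ 1ℤ)         ≡⟨ sym (∑-distrib-+ (at (v - 1ℤ)) (at (v ℤ.+ 1ℤ))) ⟩
  sum (λ j → at (v - 1ℤ) j + at (v ℤ.+ 1ℤ) j)         ≡⟨ sum-cong-≗ pointwise ⟩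
  sum (λ j → (at v j + at v j) + occupied j)          ≡⟨ ∑-distrib-+ (λ j → at v j + at v j) occupied ⟩
  sum (λ j → at v j + at v j) + occupancy W D v       ≡⟨ cong (_+ occupancy W D v) (∑-distrib-+ (at v) (at v)) ⟩
  (excess W D v + excess W D v) + occupancy W D v     ∎
  where
  open ≡-Reasoning
  at : ℤ → Vector ℕ _
  at u j = if W j then (D j - u) ⁺ else 0
  occupied : Vector ℕ _
  occupied j = if W j then δ₀ (D j - v) else 0
  masked-second-difference : ∀ b y →
    (if b then (y ℤ.+ 1ℤ) ⁺ else 0) + (if b then (y - 1ℤ) ⁺ else 0)
      ≡ ((if b then y ⁺ else 0) + (if b then y ⁺ else 0)) + (if b then δ₀ y else 0)
  masked-second-difference true  y = ⁺-second-difference y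
  masked-second-difference false y = refl
  pointwise : ∀ j → at (v - 1ℤ) j + at (v ℤ.+ 1ℤ) j ≡ (at v j + at v j) + occupied j
  pointwise j rewrite sub-pred (D j) v | sub-suc (D j) v = masked-second-difference (W j) (D j - v)

capacity-second-difference : ∀ m v →
  capacity m (v - 1ℤ) + capacity m (v ℤ.+ 1ℤ) ℕ.≤ suc (capacity m v + capacity m v)
capacity-second-difference m v rewrite sub-pred (+ m) v | sub-suc (+ m) v =
  triangle-⁺-second-difference (+ m - v)

excess-slack : ∀ {n} {W : Fin n → Bool} {m D x y v} → Dominated W m D →
  x ≢ y → T (W x) → T (W y) → D x ≡ v → D y ≡ v → excess W D v ℕ.< capacity m v
excess-slack {W = W} {m} {D} {x} {y} {v} dom x≢y Wx Wy Dx Dy = double-cancel-< (ℕ.≤-pred (begin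
  suc (suc (Φ + Φ))                             ≡⟨ ℕ.+-comm 2 (Φ + Φ) ⟩
  (Φ + Φ) + 2                                   ≤⟨ ℕ.+-monoʳ-≤ (Φ + Φ) two-occupied ⟩
  (Φ + Φ) + occupancy W D v                     ≡⟨ sym (excess-second-difference W D v) ⟩
  excess W D (v - 1ℤ) + excess W D (v ℤ.+ 1ℤ)   ≤⟨ ℕ.+-mono-≤ (dom _) (dom _) ⟩
  capacity m (v - 1ℤ) + capacity m (v ℤ.+ 1ℤ)   ≤⟨ capacity-second-difference m v ⟩
  suc (capacity m v + capacity m v)             ∎))
  where
  open ℕ.≤-Reasoning
  Φ = excess W D v
  occupied : ∀ {j} → T (W j) → D j ≡ v → (if W j then δ₀ (D j - v) else 0) ≡ 1
  occupied Wj Dj = trans (if-T Wj) (δ₀-≡ Dj)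
  two-occupied : 2 ℕ.≤ occupancy W D v
  two-occupied = subst (ℕ._≤ occupancy W D v) (cong₂ _+_ (occupied Wx Dx) (occupied Wy Dy))
    (∑-≥-pair _ x≢y)

-- A move with the order of the two labels forgotten, so that it is stable under mirror.
record Fired {n} (D D′ : Config n) (x y : Fin n) : Set where
  field
    distinct : x ≢ y
    together : D x ≡ D y
    leftward : D′ x ≡ D x - 1ℤ
    rightward : D′ y ≡ D y ℤ.+ 1ℤ
    unmoved : ∀ j → j ≢ x → j ≢ y → D′ j ≡ D j

fire-fired : ∀ {n} {C : Config n} {a b} → toℕ a ℕ.< toℕ b → C a ≡ C b → Fired C (fire C a b) a b
fire-fired {C = C} {a} {b} a<b Ca≡Cb = record
  { distinct = a≢b ; together = Ca≡Cb ; leftward = leftward ; rightward = rightward ; unmoved = unmoved }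
  where
  a≢b : a ≢ b
  a≢b refl = ℕ.<-irrefl refl a<b
  leftward : fire C a b a ≡ C a - 1ℤ
  leftward with a ≟ a
  ... | yes _   = refl
  ... | no a≢a  = contradiction refl a≢a
  rightward : fire C a b b ≡ C b ℤ.+ 1ℤ
  rightward with b ≟ a
  ... | yes b≡a = contradiction (sym b≡a) a≢b
  ... | no _ with b ≟ b
  ...   | yes _  = refl
  ...   | no b≢b = contradiction refl b≢b
  unmoved : ∀ j → j ≢ a → j ≢ b → fire C a b j ≡ C j
  unmoved j j≢a j≢b with j ≟ a
  ... | yes j≡a = contradiction j≡a j≢a
  ... | no _ with j ≟ b
  ...   | yes j≡b = contradiction j≡b j≢b
  ...   | no _    = refl

mirror : ∀ {n} → Config n → Config n
mirror C j = - C j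

fired-mirror : ∀ {n} {D D′ : Config n} {x y} → Fired D D′ x y → Fired (mirror D) (mirror D′) y x
fired-mirror {D = D} {x = x} {y} F = record
  { distinct = λ y≡x → distinct (sym y≡x)
  ; together = cong -_ (sym together)
  ; leftward = trans (cong -_ rightward) (ℤ.neg-distrib-+ (D y) 1ℤ)
  ; rightward = trans (cong -_ leftward) (ℤ.neg-distrib-+ (D x) (- 1ℤ))
  ; unmoved = λ j j≢y j≢x → cong -_ (unmoved j j≢x j≢y)
  }
  where open Fired F

pair-excess-≤ : ∀ b c q → (T c → T b) →
  (if b then (q - 1ℤ) ⁺ else 0) + (if c then (q ℤ.+ 1ℤ) ⁺ else 0)
    ℕ.≤ (if c then δ₀ q else 0) + ((if b then q ⁺ else 0) + (if c then q ⁺ else 0))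
pair-excess-≤ true  true  q _   =
  ℕ.≤-reflexive (trans (ℕ.+-comm ((q - 1ℤ) ⁺) _) (trans (⁺-second-difference q) (ℕ.+-comm _ (δ₀ q))))
pair-excess-≤ true  false q _   = ℕ.+-monoˡ-≤ 0 (⁺-pred-≤ q)
pair-excess-≤ false true  q c⇒b = ⊥-elim (c⇒b _)
pair-excess-≤ false false q _   = z≤n

excess-fired : ∀ {n} {W : Fin n → Bool} {D D′ x y} → Fired D D′ x y → (T (W y) → T (W x)) →
  ∀ v → excess W D′ v ℕ.≤ (if W y then δ₀ (D x - v) else 0) + excess W D v
excess-fired {W = W} {D} {D′} {x} {y} F closed v = ∑-≤-pair _ distinct pair apart
  where
  open Fired F
  pair : (if W x then (D′ x - v) ⁺ else 0) + (if W y then (D′ y - v) ⁺ else 0)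
           ℕ.≤ (if W y then δ₀ (D x - v) else 0)
               + ((if W x then (D x - v) ⁺ else 0) + (if W y then (D y - v) ⁺ else 0))
  pair rewrite leftward | rightward | sym together | pred-sub (D x) v | suc-sub (D x) v =
    pair-excess-≤ (W x) (W y) (D x - v) closed
  apart : ∀ j → j ≢ x → j ≢ y → (if W j then (D′ j - v) ⁺ else 0) ℕ.≤ (if W j then (D j - v) ⁺ else 0)
  apart j j≢x j≢y = ℕ.≤-reflexive (cong (λ z → if W j then (z - v) ⁺ else 0) (unmoved j j≢x j≢y))

dominated-fired : ∀ {n} {W : Fin n → Bool} {m D D′ x y} → Fired D D′ x y → (T (W y) → T (W x)) →
  Dominated W m D → Dominated W m D′
dominated-fired {W = W} {m} {D} {x = x} {y} F closed dom v =
  ℕ.≤-trans (excess-fired F closed v) (cost-≤ closed)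
  where
  open Fired F
  cost-≤ : (T (W y) → T (W x)) → (if W y then δ₀ (D x - v) else 0) + excess W D v ℕ.≤ capacity m v
  cost-≤ closed with W y in Wy
  ... | false = dom v
  ... | true with D x ℤ.≟ v
  ...   | yes Dx≡v = subst (λ z → z + excess W D v ℕ.≤ capacity m v) (sym (δ₀-≡ Dx≡v))
          (excess-slack dom distinct (closed _) (subst T (sym Wy) _) Dx≡v (trans (sym together) Dx≡v))
  ...   | no Dx≢v  = subst (λ z → z + excess W D v ℕ.≤ capacity m v) (sym (δ₀-≢ Dx≢v)) (dom v)

dominated-⟶* : ∀ {n} {W : Fin n → Bool} {m} {C E : Config n} →
  (∀ {a b : Fin n} → toℕ a ℕ.< toℕ b → T (W b) → T (W a)) →
  C ⟶* E → Dominated W m C → Dominated W m E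
dominated-⟶* closed done = id
dominated-⟶* closed (step (move a b a<b Ca≡Cb) C⟶E) dom =
  dominated-⟶* closed C⟶E (dominated-fired (fire-fired a<b Ca≡Cb) (closed a<b) dom)

mirror-dominated-⟶* : ∀ {n} {W : Fin n → Bool} {m} {C E : Config n} →
  (∀ {a b : Fin n} → toℕ a ℕ.< toℕ b → T (W a) → T (W b)) →
  C ⟶* E → Dominated W m (mirror C) → Dominated W m (mirror E)
mirror-dominated-⟶* closed done = id
mirror-dominated-⟶* closed (step (move a b a<b Ca≡Cb) C⟶E) dom =
  mirror-dominated-⟶* closed C⟶E (dominated-fired (fired-mirror (fire-fired a<b Ca≡Cb)) (closed a<b) dom)

dominated-Δ : ∀ {n} {W : Fin n → Bool} {m} → ∣ W ∣ ℕ.≤ suc (m + m) → Dominated W m (Δ n)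
dominated-Δ {n} {W} {m} small v = begin
  excess W (Δ n) v             ≡⟨ ∑-if-const W ((0ℤ - v) ⁺) ⟩
  ∣ W ∣ * (0ℤ - v) ⁺           ≤⟨ ℕ.*-monoˡ-≤ ((0ℤ - v) ⁺) small ⟩
  suc (m + m) * (0ℤ - v) ⁺     ≤⟨ below v ⟩
  capacity m v                 ∎
  where
  open ℕ.≤-Reasoning
  below : ∀ v → suc (m + m) * (0ℤ - v) ⁺ ℕ.≤ capacity m v
  below (+ zero)   rewrite ℕ.*-zeroʳ (suc (m + m)) = z≤n
  below (+ suc _)  rewrite ℕ.*-zeroʳ (suc (m + m)) = z≤n
  below -[1+ k ]   = odd-*-≤-triangle m (suc k)

dominated⇒≤ : ∀ {n} {W : Fin n → Bool} {m D} → Dominated W m D → ∀ i → T (W i) → D i ≤ + m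
dominated⇒≤ {W = W} {m} {D} dom i Wi = ℤ.i-j≤0⇒i≤j (⁺≡0⇒≤0 (ℕ.n≤0⇒n≡0 (begin
  (D i - + m) ⁺                       ≡⟨ sym (if-T Wi) ⟩
  (if W i then (D i - + m) ⁺ else 0)  ≤⟨ ∑-≥-term _ i ⟩
  excess W D (+ m)                    ≤⟨ dom (+ m) ⟩
  capacity m (+ m)                    ≡⟨ cong (λ z → triangle (z ⁺)) (ℤ.+-inverseʳ (+ m)) ⟩
  0                                   ∎)))
  where open ℕ.≤-Reasoning

reachable-≤ : ∀ {n} (W : Fin n → Bool) {m} {C : Config n} →
  (∀ {a b : Fin n} → toℕ a ℕ.< toℕ b → T (W b) → T (W a)) →
  ∣ W ∣ ℕ.≤ suc (m + m) → Δ n ⟶* C → ∀ i → T (W i) → C i ≤ + m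
reachable-≤ W closed small Δ⟶C = dominated⇒≤ (dominated-⟶* closed Δ⟶C (dominated-Δ {W = W} small))

reachable-≥ : ∀ {n} (W : Fin n → Bool) {m} {C : Config n} →
  (∀ {a b : Fin n} → toℕ a ℕ.< toℕ b → T (W a) → T (W b)) →
  ∣ W ∣ ℕ.≤ suc (m + m) → Δ n ⟶* C → ∀ i → T (W i) → - (+ m) ≤ C i
reachable-≥ W {m} {C} closed small Δ⟶C i Wi = subst (- (+ m) ≤_) (ℤ.neg-involutive (C i))
  (ℤ.neg-mono-≤ (dominated⇒≤ {W = W} {D = mirror C} (mirror-dominated-⟶* closed Δ⟶C (dominated-Δ {W = W} small)) i Wi))

lemma2p12 : (n : ℕ) → 1 Data.Nat.≤ n → (C : Config n) → Δ n ⟶* C →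
    (i : Fin n) →
      (- (+ ((n ∸ toℕ i) / 2)) ≤ C i) × (C i ≤ + (suc (toℕ i) / 2))
lemma2p12 n _ C Δ⟶C i = lower , upper
  where
  k = toℕ i
  upper : C i ≤ + (suc k / 2)
  upper = reachable-≤ (λ j → toℕ j <ᵇ suc k)
    (λ {_} {b} a<b b≤k → ℕ.<⇒<ᵇ (ℕ.<-trans a<b (ℕ.<ᵇ⇒< (toℕ b) (suc k) b≤k)))
    (ℕ.≤-trans (count-<ᵇ n (suc k)) (≤-suc-double-/2 (suc k)))
    Δ⟶C i (ℕ.<⇒<ᵇ (ℕ.n<1+n k))
  lower : - (+ ((n ∸ k) / 2)) ≤ C i
  lower = reachable-≥ (λ j → k ≤ᵇ toℕ j)
    (λ a<b k≤a → ℕ.≤⇒≤ᵇ (ℕ.≤-trans (ℕ.≤ᵇ⇒≤ k _ k≤a) (ℕ.<⇒≤ a<b)))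
    (ℕ.≤-trans (count-≤ᵇ n k) (≤-suc-double-/2 (n ∸ k)))
    Δ⟶C i (ℕ.≤⇒≤ᵇ (ℕ.≤-refl {k}))
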